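{- Let $n \ge 1$ be an integer and let $f \in R$. Then $f \in \mathcal{P}_n$ if and only if there exists $h \in \mathcal{P}_n$ with $f \equiv h \pmod{\mu_n}$.
   Context: $R := 1 + x\mathbb{Z}[[x]]$ is the set of formal power series with integer coefficients and constant term $1$. For an integer $n \ge 1$, $\mathcal{P}_n := \{ g^n \mid g \in R\}$, and $\mu_n := n \prod_{p \mid n} p$ (product over the primes dividing $n$). For power series $a, b$ with integer coefficients and an integer $m$, $a \equiv b \pmod{m}$ means every coefficient of $a-b$ is divisible by $m$. -}

module Defs where

open import Data.Nat as ℕ using (ℕ; zero; suc; _∸_)
open import Data.Nat.Divisibility using (_∣?_)
open import Data.Nat.Primality using (prime?)
open import Data.Integer as ℤ using (ℤ; +_)
open import Data.Integer.Divisibility using (_∣_)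
open import Data.List using (List; upTo; map; filter)
open import Data.Nat.ListAction using (product)
open import Data.Product using (Σ; _×_)
open import Relation.Binary.PropositionalEquality using (_≡_)
open import Relation.Nullary.Decidable using (_×-dec_)

Series : Set
Series = ℕ → ℤ

_≈_ : Series → Series → Set
a ≈ b = ∀ k → a k ≡ b k

one : Series
one zero    = + 1
one (suc _) = + 0

sumTo : ℕ → (ℕ → ℤ) → ℤ
sumTo zero    f = f 0
sumTo (suc k) f = sumTo k f ℤ.+ f (suc k)

_⋆_ : Series → Series → Series
(a ⋆ b) k = sumTo k (λ i → a i ℤ.* b (k ∸ i))

_^^_ : Series → ℕ → Series
a ^^ zero  = one
a ^^ suc n = a ⋆ (a ^^ n)

InR : Series → Set
InR f = f 0 ≡ + 1

InP : ℕ → Series → Set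
InP n f = Σ Series (λ g → InR g × (f ≈ (g ^^ n)))

μ : ℕ → ℕ
μ n = n ℕ.* product (filter (λ p → prime? p ×-dec p ∣? n) (upTo (suc n)))

CongMod : Series → Series → ℕ → Set
CongMod a b m = ∀ k → (+ m) ∣ (a k ℤ.- b k)

-- Write μ n = n r, where r is the product of the primes dividing n. If x ≡ y (mod m) and d ∣ m, the
-- binomial expansion of (y + m t)^d shows x^d ≡ y^d (mod d m); applying this along a prime factorisation
-- of n, whose factors all divide r, gives: x ≡ y (mod r) implies x^n ≡ y^n (mod n r).
-- Now let f ≡ u^n (mod n r) with u ∈ R. Build g = u + r t one coefficient at a time. Since g ≡ u (mod r),
-- g^n ≡ u^n ≡ f (mod n r); and since g₀ = 1, adding c to the coefficient of x^(k+1) in g adds n c to that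
-- of g^n and leaves lower ones unchanged. So if g^n agrees with f below degree k + 1, the difference in
-- degree k + 1 is n r c for some c, and adding r c to g removes it while keeping g ≡ u (mod r).
module Submission where

open import Algebra.Bundles using (CommutativeSemiring)
open import Algebra.Structures using (IsCommutativeMonoid)
open import Algebra.Structures.Biased using (isCommutativeSemiringˡ)
open import Data.List using ([]; _∷_; upTo; filter)
open import Data.List.Membership.Propositional using (_∈_)
open import Data.List.Membership.Propositional.Properties using (∈-upTo⁺; ∈-filter⁺)
open import Data.List.Relation.Unary.All as All using (All; []; _∷_)
open import Data.Nat as ℕ using (ℕ; zero; suc; _∸_; _≤_; _<_; _≥_; z≤n; s≤s; NonZero)
open import Data.Nat.Divisibility using (_∣_; _∣?_; _∣0; divides; ∣n⇒∣m*n; ∣⇒≤)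
open import Data.Nat.ListAction using (product)
open import Data.Nat.ListAction.Properties using (∈⇒∣product)
open import Data.Nat.Primality using (Prime; prime?)
open import Data.Nat.Primality.Factorisation using (factorise; PrimeFactorisation)
import Data.Nat.Properties as ℕ
import Data.Nat.Tactic.RingSolver as ℕ
open import Data.Product using (∃-syntax; _,_)
open import Data.Sum using (inj₁; inj₂)
open import Function using (_∘_; flip)
open import Function.Bundles using (_⇔_; mk⇔)
open import Level using (0ℓ; _⊔_)
open import Relation.Binary.PropositionalEquality as ≡ using (_≡_)
open import Relation.Binary.Structures using (IsEquivalence)
open import Relation.Nullary using (yes; no; contradiction)
open import Relation.Nullary.Decidable using (_×-dec_)

module PowerCongruence {c ℓ} (R : CommutativeSemiring c ℓ) where

  open CommutativeSemiring R
  open import Algebra.Properties.Semiring.Mult semiring using (_×_; ×-congˡ; ×-congʳ; ×-assoc-*; ×1-homo-*)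
  open import Algebra.Properties.Semiring.Exp semiring using (_^_; ^-congʳ; ^-assocʳ)
  open import Algebra.Solver.Ring.NaturalCoefficients.Default R using (solve; con; _:+_; _:*_; _:=_)
  open import Relation.Binary.Reasoning.Setoid setoid

  -- Without subtraction, a congruence is witnessed by the quotient t.
  infix 4 _≡_[mod_]
  _≡_[mod_] : Carrier → Carrier → ℕ → Set (c ⊔ ℓ)
  x ≡ y [mod m ] = ∃[ t ] x ≈ y + m × t

  ≡-mod-resp : ∀ {x x′ y y′ m m′} → x ≈ x′ → y ≈ y′ → m ≡ m′ →
               x ≡ y [mod m ] → x′ ≡ y′ [mod m′ ]
  ≡-mod-resp x≈x′ y≈y′ ≡.refl (t , x≈y+mt) = t , trans (sym x≈x′) (trans x≈y+mt (+-congʳ y≈y′))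

  ×≈×1* : ∀ m t → m × t ≈ (m × 1#) * t
  ×≈×1* m t = sym (trans (×-assoc-* m 1# t) (×-congʳ m (*-identityˡ t)))

  first-order-binomial : ∀ {x y M t} → x ≈ y + M * t → ∀ j →
    ∃[ e ] x ^ suc j ≈ y ^ suc j + (suc j × 1#) * (M * (t * y ^ j)) + M * (M * e)
  first-order-binomial {x} {y} {M} {t} x≈y+Mt zero = 0# , (begin
    x * 1#                                       ≈⟨ *-congʳ x≈y+Mt ⟩
    (y + M * t) * 1#                             ≈⟨ solve 3 (λ y M t → (y :+ M :* t) :* con 1
                                                      := y :* con 1 :+ (con 1 :+ con 0) :* (M :* (t :* con 1))
                                                         :+ M :* (M :* con 0)) refl y M t ⟩
    y * 1# + (1# + 0#) * (M * (t * 1#)) + M * (M * 0#) ∎)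
  first-order-binomial {x} {y} {M} {t} x≈y+Mt (suc j) with first-order-binomial x≈y+Mt j
  ... | e , xʲ⁺¹≈ = y * e + D * (t * (t * y ^ j)) + t * (M * e) , (begin
    x * x ^ suc j
      ≈⟨ *-cong x≈y+Mt xʲ⁺¹≈ ⟩
    (y + M * t) * (y ^ suc j + D * (M * (t * y ^ j)) + M * (M * e))
      ≈⟨ solve 6 (λ y yʲ M t D e →
           (y :+ M :* t) :* (y :* yʲ :+ D :* (M :* (t :* yʲ)) :+ M :* (M :* e))
           := y :* (y :* yʲ) :+ (con 1 :+ D) :* (M :* (t :* (y :* yʲ)))
              :+ M :* (M :* (y :* e :+ D :* (t :* (t :* yʲ)) :+ t :* (M :* e))))
           refl y (y ^ j) M t D e ⟩
    y ^ suc (suc j) + (suc (suc j) × 1#) * (M * (t * y ^ suc j))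
      + M * (M * (y * e + D * (t * (t * y ^ j)) + t * (M * e))) ∎)
    where
    D : Carrier
    D = suc j × 1#

  ^-≡-mod-* : ∀ {x y m} d → d ∣ m → x ≡ y [mod m ] → x ^ d ≡ y ^ d [mod d ℕ.* m ]
  ^-≡-mod-* zero _ _ = 0# , sym (+-identityʳ 1#)
  ^-≡-mod-* {x} {y} {m} d@(suc j) (divides q m≡q*d) (t , x≈y+mt)
    with first-order-binomial (trans x≈y+mt (+-congˡ (×≈×1* m t))) j
  ... | e , xᵈ≈ = t * y ^ j + Q * e , (begin
    x ^ d                                         ≈⟨ xᵈ≈ ⟩
    y ^ d + D * (M * (t * y ^ j)) + M * (M * e)   ≈⟨ +-congˡ (*-congˡ (*-congʳ M≈Q*D)) ⟩
    y ^ d + D * (M * (t * y ^ j)) + M * (Q * D * e)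
      ≈⟨ solve 6 (λ yᵈ D M w Q e → yᵈ :+ D :* (M :* w) :+ M :* (Q :* D :* e)
                                  := yᵈ :+ D :* M :* (w :+ Q :* e)) refl (y ^ d) D M (t * y ^ j) Q e ⟩
    y ^ d + D * M * (t * y ^ j + Q * e)           ≈⟨ +-congˡ (*-congʳ (sym (×1-homo-* d m))) ⟩
    y ^ d + (d ℕ.* m) × 1# * (t * y ^ j + Q * e)  ≈⟨ +-congˡ (sym (×≈×1* (d ℕ.* m) _)) ⟩
    y ^ d + (d ℕ.* m) × (t * y ^ j + Q * e)       ∎)
    where
    D M Q : Carrier
    D = d × 1#
    M = m × 1#
    Q = q × 1#
    -- d ∣ m makes M * M a multiple of D * M.
    M≈Q*D : M ≈ Q * D
    M≈Q*D = trans (×-congˡ m≡q*d) (×1-homo-* q d)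

  ^-≡-mod-product : ∀ {x y m} ps → All (_∣ m) ps → x ≡ y [mod m ] →
                    x ^ product ps ≡ y ^ product ps [mod product ps ℕ.* m ]
  ^-≡-mod-product {x} {y} {m} [] [] x≡y =
    ≡-mod-resp (sym (*-identityʳ x)) (sym (*-identityʳ y)) (≡.sym (ℕ.+-identityʳ m)) x≡y
  ^-≡-mod-product {x} {y} {m} (p ∷ ps) (p∣m ∷ ps∣m) x≡y =
    ≡-mod-resp (^-assocʳ x p P) (^-assocʳ y p P) (reassociate P p m)
      (^-≡-mod-product ps (All.map (∣n⇒∣m*n p) ps∣m) (^-≡-mod-* p p∣m x≡y))
    where
    P : ℕ
    P = product ps
    reassociate : ∀ P p m → P ℕ.* (p ℕ.* m) ≡ p ℕ.* P ℕ.* m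
    reassociate = ℕ.solve-∀

  ^-≡-mod-radical : ∀ {x y m} n → (∀ p → Prime p → p ∣ n → p ∣ m) → x ≡ y [mod m ] →
                    x ^ n ≡ y ^ n [mod n ℕ.* m ]
  ^-≡-mod-radical zero _ _ = 0# , sym (+-identityʳ 1#)
  ^-≡-mod-radical {x} {y} {m} n@(suc _) rad x≡y =
    ≡-mod-resp (^-congʳ x (≡.sym n≡P)) (^-congʳ y (≡.sym n≡P)) (≡.cong (ℕ._* m) (≡.sym n≡P))
      (^-≡-mod-product ps (All.tabulate factor∣m) x≡y)
    where
    open PrimeFactorisation (factorise n) renaming (factors to ps; isFactorisation to n≡P; factorsPrime to ps-prime)
    factor∣m : ∀ {p} → p ∈ ps → p ∣ m
    factor∣m {p} p∈ps =
      rad p (All.lookup ps-prime p∈ps) (≡.subst (p ∣_) (≡.sym n≡P) (∈⇒∣product p∈ps))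

-- Imported only after PowerCongruence, whose semiring operations they would clash with.
open import Defs
open import Data.Integer as ℤ using (ℤ; +_; _+_; _*_; _-_)
open import Data.Product using (Σ; _×_)
import Data.Integer.Divisibility.Signed as ℤ
import Data.Integer.Properties as ℤ
open import Data.Integer.Tactic.RingSolver using (solve-∀)
open ≡ using (refl; sym; trans; cong; cong₂; subst)
open ≡.≡-Reasoning

sumTo-cong : ∀ k {F G : ℕ → ℤ} → (∀ i → i ≤ k → F i ≡ G i) → sumTo k F ≡ sumTo k G
sumTo-cong zero    F≡G = F≡G 0 z≤n
sumTo-cong (suc k) F≡G =
  cong₂ _+_ (sumTo-cong k (λ i i≤k → F≡G i (ℕ.m≤n⇒m≤1+n i≤k))) (F≡G (suc k) ℕ.≤-refl)

sumTo-distrib-+ : ∀ k (F G : ℕ → ℤ) → sumTo k (λ i → F i + G i) ≡ sumTo k F + sumTo k G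
sumTo-distrib-+ zero    F G = refl
sumTo-distrib-+ (suc k) F G = begin
  sumTo k (λ i → F i + G i) + (F (suc k) + G (suc k))
    ≡⟨ cong (_+ (F (suc k) + G (suc k))) (sumTo-distrib-+ k F G) ⟩
  sumTo k F + sumTo k G + (F (suc k) + G (suc k))
    ≡⟨ interchange (sumTo k F) (sumTo k G) (F (suc k)) (G (suc k)) ⟩
  sumTo k F + F (suc k) + (sumTo k G + G (suc k)) ∎
  where
  interchange : ∀ a b c d → a + b + (c + d) ≡ a + c + (b + d)
  interchange = solve-∀

sumTo-*ˡ : ∀ k z (F : ℕ → ℤ) → sumTo k (λ i → z * F i) ≡ z * sumTo k F
sumTo-*ˡ zero    z F = refl
sumTo-*ˡ (suc k) z F =
  trans (cong (_+ z * F (suc k)) (sumTo-*ˡ k z F)) (sym (ℤ.*-distribˡ-+ z (sumTo k F) (F (suc k))))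

sumTo-head : ∀ k (F : ℕ → ℤ) → (∀ i → 0 < i → i ≤ k → F i ≡ + 0) → sumTo k F ≡ F 0
sumTo-head zero    F _      = refl
sumTo-head (suc k) F F≡0 = begin
  sumTo k F + F (suc k)
    ≡⟨ cong₂ _+_ (sumTo-head k F (λ i 0<i i≤k → F≡0 i 0<i (ℕ.m≤n⇒m≤1+n i≤k))) (F≡0 (suc k) (s≤s z≤n) ℕ.≤-refl) ⟩
  F 0 + + 0
    ≡⟨ ℤ.+-identityʳ (F 0) ⟩
  F 0 ∎

sumTo-suc : ∀ k (F : ℕ → ℤ) → sumTo (suc k) F ≡ F 0 + sumTo k (F ∘ suc)
sumTo-suc zero    F = refl
sumTo-suc (suc k) F = trans (cong (_+ F (suc (suc k))) (sumTo-suc k F)) (ℤ.+-assoc (F 0) _ _)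

sumTo-reverse : ∀ k (F : ℕ → ℤ) → sumTo k F ≡ sumTo k (λ i → F (k ∸ i))
sumTo-reverse zero    F = refl
sumTo-reverse (suc k) F = begin
  sumTo (suc k) F
    ≡⟨ sumTo-suc k F ⟩
  F 0 + sumTo k (F ∘ suc)
    ≡⟨ cong (_+_ (F 0)) (sumTo-reverse k (F ∘ suc)) ⟩
  F 0 + sumTo k (λ i → F (suc (k ∸ i)))
    ≡⟨ cong (_+_ (F 0)) (sumTo-cong k (λ i i≤k → cong F (sym (ℕ.+-∸-assoc 1 i≤k)))) ⟩
  F 0 + sumTo k (λ i → F (suc k ∸ i))
    ≡⟨ ℤ.+-comm (F 0) _ ⟩
  sumTo k (λ i → F (suc k ∸ i)) + F 0
    ≡⟨ cong (λ j → sumTo k (λ i → F (suc k ∸ i)) + F j) (sym (ℕ.n∸n≡0 k)) ⟩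
  sumTo (suc k) (λ i → F (suc k ∸ i)) ∎

triangle : ℕ → (ℕ → ℕ → ℤ) → ℤ
triangle k F = sumTo k (λ i → sumTo (k ∸ i) (F i))

triangle-suc-row : ∀ k F → triangle (suc k) F ≡ sumTo (suc k) (F 0) + triangle k (F ∘ suc)
triangle-suc-row k F = sumTo-suc k (λ i → sumTo (suc k ∸ i) (F i))

triangle-suc-column : ∀ k F → triangle (suc k) F ≡ sumTo (suc k) (flip F 0) + triangle k (λ i j → F i (suc j))
triangle-suc-column k F = begin
  sumTo k (λ i → sumTo (suc k ∸ i) (F i)) + sumTo (suc k ∸ suc k) (F (suc k))
    ≡⟨ cong₂ _+_ (sumTo-cong k (λ i i≤k →
                    trans (cong (λ j → sumTo j (F i)) (ℕ.+-∸-assoc 1 i≤k)) (sumTo-suc (k ∸ i) (F i))))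
                 (cong (λ j → sumTo j (F (suc k))) (ℕ.n∸n≡0 k)) ⟩
  sumTo k (λ i → F i 0 + sumTo (k ∸ i) (λ j → F i (suc j))) + F (suc k) 0
    ≡⟨ cong (_+ F (suc k) 0) (sumTo-distrib-+ k (flip F 0) _) ⟩
  sumTo k (flip F 0) + triangle k (λ i j → F i (suc j)) + F (suc k) 0
    ≡⟨ swap (sumTo k (flip F 0)) _ _ ⟩
  sumTo (suc k) (flip F 0) + triangle k (λ i j → F i (suc j)) ∎
  where
  swap : ∀ a b c → a + b + c ≡ a + c + b
  swap = solve-∀

triangle-transpose : ∀ k F → triangle k F ≡ triangle k (flip F)
triangle-transpose zero    F = refl
triangle-transpose (suc k) F = begin
  triangle (suc k) F
    ≡⟨ triangle-suc-column k F ⟩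
  sumTo (suc k) (flip F 0) + triangle k (λ i j → F i (suc j))
    ≡⟨ cong (_+_ (sumTo (suc k) (flip F 0))) (triangle-transpose k _) ⟩
  sumTo (suc k) (flip F 0) + triangle k (λ i j → F j (suc i))
    ≡⟨ triangle-suc-row k (flip F) ⟨
  triangle (suc k) (flip F) ∎

_+ₛ_ : Series → Series → Series
(a +ₛ b) k = a k + b k

0ₛ : Series
0ₛ _ = + 0

≈-refl : ∀ {a} → a ≈ a
≈-refl _ = refl

≈-isEquivalence : IsEquivalence _≈_
≈-isEquivalence = record
  { refl  = ≈-refl
  ; sym   = λ a≈b k → sym (a≈b k)
  ; trans = λ a≈b b≈d k → trans (a≈b k) (b≈d k) }

⋆-cong : ∀ {a a′ b b′} → a ≈ a′ → b ≈ b′ → (a ⋆ b) ≈ (a′ ⋆ b′)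
⋆-cong a≈a′ b≈b′ k = sumTo-cong k (λ i _ → cong₂ _*_ (a≈a′ i) (b≈b′ (k ∸ i)))

⋆-comm : ∀ a b → (a ⋆ b) ≈ (b ⋆ a)
⋆-comm a b k = trans (sumTo-reverse k _) (sumTo-cong k (λ i i≤k →
  trans (cong (λ j → a (k ∸ i) * b j) (ℕ.m∸[m∸n]≡n i≤k)) (ℤ.*-comm (a (k ∸ i)) (b i))))

⋆-identityˡ : ∀ a → (one ⋆ a) ≈ a
⋆-identityˡ a k = trans (sumTo-head k _ (λ { (suc i) _ _ → ℤ.*-zeroˡ (a (k ∸ suc i)) })) (ℤ.*-identityˡ (a k))

⋆-zeroˡ : ∀ a → (0ₛ ⋆ a) ≈ 0ₛ
⋆-zeroˡ a k = trans (sumTo-head k _ (λ i _ _ → ℤ.*-zeroˡ (a (k ∸ i)))) (ℤ.*-zeroˡ (a k))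

⋆-distribʳ-+ₛ : ∀ a b d → ((b +ₛ d) ⋆ a) ≈ ((b ⋆ a) +ₛ (d ⋆ a))
⋆-distribʳ-+ₛ a b d k =
  trans (sumTo-cong k (λ i _ → ℤ.*-distribʳ-+ (a (k ∸ i)) (b i) (d i))) (sumTo-distrib-+ k _ _)

⋆-leftComm : ∀ a b d → (a ⋆ (b ⋆ d)) ≈ (b ⋆ (a ⋆ d))
⋆-leftComm a b d k = begin
  sumTo k (λ i → a i * sumTo (k ∸ i) (λ j → b j * d (k ∸ i ∸ j)))
    ≡⟨ sumTo-cong k (λ i _ → sumTo-*ˡ (k ∸ i) (a i) _) ⟨
  triangle k (λ i j → a i * (b j * d (k ∸ i ∸ j)))
    ≡⟨ triangle-transpose k _ ⟩
  triangle k (λ i j → a j * (b i * d (k ∸ j ∸ i)))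
    ≡⟨ sumTo-cong k (λ i _ → sumTo-cong (k ∸ i) (λ j _ →
         trans (rearrange (a j) (b i) _) (cong (λ m → b i * (a j * d m)) (∸-swap k j i)))) ⟩
  triangle k (λ i j → b i * (a j * d (k ∸ i ∸ j)))
    ≡⟨ sumTo-cong k (λ i _ → sumTo-*ˡ (k ∸ i) (b i) _) ⟩
  sumTo k (λ i → b i * sumTo (k ∸ i) (λ j → a j * d (k ∸ i ∸ j))) ∎
  where
  rearrange : ∀ x y z → x * (y * z) ≡ y * (x * z)
  rearrange = solve-∀
  ∸-swap : ∀ k j i → k ∸ j ∸ i ≡ k ∸ i ∸ j
  ∸-swap k j i = trans (ℕ.∸-+-assoc k j i) (trans (cong (k ∸_) (ℕ.+-comm j i)) (sym (ℕ.∸-+-assoc k i j)))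

⋆-assoc : ∀ a b d → ((a ⋆ b) ⋆ d) ≈ (a ⋆ (b ⋆ d))
⋆-assoc a b d k = begin
  ((a ⋆ b) ⋆ d) k  ≡⟨ ⋆-comm (a ⋆ b) d k ⟩
  (d ⋆ (a ⋆ b)) k  ≡⟨ ⋆-cong (≈-refl {d}) (⋆-comm a b) k ⟩
  (d ⋆ (b ⋆ a)) k  ≡⟨ ⋆-leftComm d b a k ⟩
  (b ⋆ (d ⋆ a)) k  ≡⟨ ⋆-cong (≈-refl {b}) (⋆-comm d a) k ⟩
  (b ⋆ (a ⋆ d)) k  ≡⟨ ⋆-leftComm b a d k ⟩
  (a ⋆ (b ⋆ d)) k  ∎

+ₛ-isCommutativeMonoid : IsCommutativeMonoid _≈_ _+ₛ_ 0ₛ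
+ₛ-isCommutativeMonoid = record
  { isMonoid = record
    { isSemigroup = record
      { isMagma = record { isEquivalence = ≈-isEquivalence ; ∙-cong = λ p q k → cong₂ _+_ (p k) (q k) }
      ; assoc = λ a b d k → ℤ.+-assoc (a k) (b k) (d k) }
    ; identity = (λ a k → ℤ.+-identityˡ (a k)) , (λ a k → ℤ.+-identityʳ (a k)) }
  ; comm = λ a b k → ℤ.+-comm (a k) (b k) }

⋆-isCommutativeMonoid : IsCommutativeMonoid _≈_ _⋆_ one
⋆-isCommutativeMonoid = record
  { isMonoid = record
    { isSemigroup = record
      { isMagma = record { isEquivalence = ≈-isEquivalence ; ∙-cong = ⋆-cong }
      ; assoc = ⋆-assoc }
    ; identity = ⋆-identityˡ , (λ a k → trans (⋆-comm a one k) (⋆-identityˡ a k)) }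
  ; comm = ⋆-comm }

series-commutativeSemiring : CommutativeSemiring 0ℓ 0ℓ
series-commutativeSemiring = record
  { isCommutativeSemiring = isCommutativeSemiringˡ record
    { +-isCommutativeMonoid = +ₛ-isCommutativeMonoid
    ; *-isCommutativeMonoid = ⋆-isCommutativeMonoid
    ; distribʳ = ⋆-distribʳ-+ₛ
    ; zeroˡ = ⋆-zeroˡ } }

open PowerCongruence series-commutativeSemiring using (_≡_[mod_]; ≡-mod-resp; ^-≡-mod-radical)
open import Algebra.Properties.Semiring.Mult (CommutativeSemiring.semiring series-commutativeSemiring)
  using () renaming (_×_ to _×ₛ_)
open import Algebra.Properties.Semiring.Exp (CommutativeSemiring.semiring series-commutativeSemiring)
  using () renaming (_^_ to _^ₛ_)

×ₛ-coefficient : ∀ m t k → (m ×ₛ t) k ≡ + m * t k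
×ₛ-coefficient zero    t k = sym (ℤ.*-zeroˡ (t k))
×ₛ-coefficient (suc m) t k = trans (cong (_+_ (t k)) (×ₛ-coefficient m t k)) (sym (ℤ.suc-* (+ m) (t k)))

^ₛ≈^^ : ∀ n a → (a ^ₛ n) ≈ (a ^^ n)
^ₛ≈^^ zero    a = ≈-refl
^ₛ≈^^ (suc n) a = ⋆-cong (≈-refl {a}) (^ₛ≈^^ n a)

-≡*⇒≡+* : ∀ {x y z w} → x - y ≡ z * w → x ≡ y + w * z
-≡*⇒≡+* {x} {y} {z} {w} x-y≡zw = trans (difference x y) (cong (_+_ y) (trans x-y≡zw (ℤ.*-comm z w)))
  where
  difference : ∀ x y → x ≡ y + (x - y)
  difference = solve-∀

≡+*⇒-≡* : ∀ {x y z w} → x ≡ y + w * z → x - y ≡ z * w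
≡+*⇒-≡* {y = y} {z} {w} refl = cancel y z w
  where
  cancel : ∀ y z w → y + w * z - y ≡ z * w
  cancel = solve-∀

CongMod⇒∣ : ∀ {a b m} → CongMod a b m → ∀ k → + m ℤ.∣ a k - b k
CongMod⇒∣ a≡b k = ℤ.∣ᵤ⇒∣ (a≡b k)

CongMod⇒≡-mod : ∀ {a b m} → CongMod a b m → a ≡ b [mod m ]
CongMod⇒≡-mod {a} {b} {m} a≡b = q , λ k →
  trans (-≡*⇒≡+* {z = q k} {+ m} (ℤ._∣_.equality (CongMod⇒∣ {a} {b} a≡b k)))
        (cong (_+_ (b k)) (sym (×ₛ-coefficient m q k)))
  where
  q : Series
  q k = ℤ.quotient (CongMod⇒∣ {a} {b} a≡b k)

≡-mod⇒CongMod : ∀ {a b m} → a ≡ b [mod m ] → CongMod a b m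
≡-mod⇒CongMod {a} {b} {m} (t , a≈b+mt) k =
  ℤ.∣⇒∣ᵤ {+ m} (ℤ.divides (t k)
    (≡+*⇒-≡* {w = + m} (trans (a≈b+mt k) (cong (_+_ (b k)) (×ₛ-coefficient m t k)))))

CongMod-refl : ∀ a m → CongMod a a m
CongMod-refl a m k = subst (λ z → m ∣ ℤ.∣ z ∣) (sym (ℤ.+-inverseʳ (a k))) (m ∣0)

CongMod-sym : ∀ {a b m} → CongMod a b m → CongMod b a m
CongMod-sym {a} {b} {m} a≡b k =
  ℤ.∣⇒∣ᵤ (subst (+ m ℤ.∣_) (negate (a k) (b k)) (ℤ.∣m⇒∣-m (CongMod⇒∣ {a} {b} a≡b k)))
  where
  negate : ∀ x y → ℤ.- (x - y) ≡ y - x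
  negate = solve-∀

CongMod-trans : ∀ {a b c m} → CongMod a b m → CongMod b c m → CongMod a c m
CongMod-trans {a} {b} {c} {m} a≡b b≡c k =
  ℤ.∣⇒∣ᵤ (subst (+ m ℤ.∣_) (telescope (a k) (b k) (c k))
    (ℤ.∣m∣n⇒∣m+n (CongMod⇒∣ {a} {b} a≡b k) (CongMod⇒∣ {b} {c} b≡c k)))
  where
  telescope : ∀ x y z → x - y + (y - z) ≡ x - z
  telescope = solve-∀

CongMod-respʳ : ∀ {a b b′ m} → b ≈ b′ → CongMod a b m → CongMod a b′ m
CongMod-respʳ {a} {m = m} b≈b′ a≡b k = subst (λ x → m ∣ ℤ.∣ a k - x ∣) (b≈b′ k) (a≡b k)

CongMod-^^ : ∀ n {r a b} → (∀ p → Prime p → p ∣ n → p ∣ r) →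
             CongMod a b r → CongMod (a ^^ n) (b ^^ n) (n ℕ.* r)
CongMod-^^ n {r} {a} {b} rad a≡b = ≡-mod⇒CongMod {a ^^ n} {b ^^ n} {n ℕ.* r}
  (≡-mod-resp {m = n ℕ.* r} (^ₛ≈^^ n a) (^ₛ≈^^ n b) refl
    (^-≡-mod-radical n rad (CongMod⇒≡-mod {a} {b} a≡b)))

AgreeUpTo : ℕ → Series → Series → Set
AgreeUpTo k a b = ∀ i → i ≤ k → a i ≡ b i

⋆-agree : ∀ {k a a′ b b′} → AgreeUpTo k a a′ → AgreeUpTo k b b′ → AgreeUpTo k (a ⋆ b) (a′ ⋆ b′)
⋆-agree a≈a′ b≈b′ j j≤k = sumTo-cong j (λ i i≤j →
  cong₂ _*_ (a≈a′ i (ℕ.≤-trans i≤j j≤k)) (b≈b′ (j ∸ i) (ℕ.≤-trans (ℕ.m∸n≤m j i) j≤k)))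

^^-agree : ∀ n {k a b} → AgreeUpTo k a b → AgreeUpTo k (a ^^ n) (b ^^ n)
^^-agree zero    _   _ _ = refl
^^-agree (suc n) a≈b   = ⋆-agree a≈b (^^-agree n a≈b)

^^-InR : ∀ n {a} → InR a → InR (a ^^ n)
^^-InR zero    _   = refl
^^-InR (suc n) a∈R = cong₂ _*_ a∈R (^^-InR n a∈R)

-- Only the terms i = 0 and i = k + 1 of the Cauchy product change; as a 0 = 1 they contribute n δ and δ.
^^-perturb : ∀ n {k a b} → InR a → AgreeUpTo k a b →
             (b ^^ n) (suc k) ≡ (a ^^ n) (suc k) + + n * (b (suc k) - a (suc k))
^^-perturb zero                _   _   = refl
^^-perturb (suc n) {k} {a} {b} a∈R a≈b = begin
  sumTo K Fb                        ≡⟨ sumTo-cong K (λ i _ → split (Fb i) (Fa i)) ⟩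
  sumTo K (λ i → Fa i + D i)        ≡⟨ sumTo-distrib-+ K Fa D ⟩
  sumTo K Fa + (sumTo k D + D K)    ≡⟨ cong (λ s → sumTo K Fa + (s + D K)) (sumTo-head k D D-interior) ⟩
  sumTo K Fa + (D 0 + D K)          ≡⟨ cong₂ (λ x y → sumTo K Fa + (x + y)) D-first D-last ⟩
  sumTo K Fa + (+ n * δ + δ)        ≡⟨ cong (_+_ (sumTo K Fa)) (collect (+ n) δ) ⟩
  sumTo K Fa + + suc n * δ          ∎
  where
  K : ℕ
  K = suc k
  δ : ℤ
  δ = b K - a K
  b∈R : InR b
  b∈R = trans (sym (a≈b 0 z≤n)) a∈R
  Fa Fb D : ℕ → ℤ
  Fa i = a i * (a ^^ n) (K ∸ i)
  Fb i = b i * (b ^^ n) (K ∸ i)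
  D i = Fb i - Fa i
  split : ∀ x y → x ≡ y + (x - y)
  split = solve-∀
  collect : ∀ m d → m * d + d ≡ (+ 1 + m) * d
  collect = solve-∀
  D-interior : ∀ i → 0 < i → i ≤ k → D i ≡ + 0
  D-interior (suc i) _ i<k = begin
    b (suc i) * (b ^^ n) (k ∸ i) - Fa (suc i)
      ≡⟨ cong (_- Fa (suc i))
              (cong₂ _*_ (sym (a≈b (suc i) i<k)) (sym (^^-agree n a≈b (k ∸ i) (ℕ.m∸n≤m k i)))) ⟩
    Fa (suc i) - Fa (suc i)  ≡⟨ ℤ.+-inverseʳ (Fa (suc i)) ⟩
    + 0                      ∎
  D-first : D 0 ≡ + n * δ
  D-first = begin
    b 0 * (b ^^ n) K - a 0 * (a ^^ n) K
      ≡⟨ cong₂ (λ x y → x * y - a 0 * (a ^^ n) K) b∈R (^^-perturb n a∈R a≈b) ⟩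
    + 1 * ((a ^^ n) K + + n * δ) - a 0 * (a ^^ n) K
      ≡⟨ cong (λ x → + 1 * ((a ^^ n) K + + n * δ) - x * (a ^^ n) K) a∈R ⟩
    + 1 * ((a ^^ n) K + + n * δ) - + 1 * (a ^^ n) K
      ≡⟨ cancel ((a ^^ n) K) (+ n * δ) ⟩
    + n * δ ∎
    where
    cancel : ∀ x d → + 1 * (x + d) - + 1 * x ≡ d
    cancel = solve-∀
  D-last : D K ≡ δ
  D-last = begin
    b K * (b ^^ n) (k ∸ k) - a K * (a ^^ n) (k ∸ k)
      ≡⟨ cong (λ j → b K * (b ^^ n) j - a K * (a ^^ n) j) (ℕ.n∸n≡0 k) ⟩
    b K * (b ^^ n) 0 - a K * (a ^^ n) 0
      ≡⟨ cong₂ (λ x y → b K * x - a K * y) (^^-InR n b∈R) (^^-InR n a∈R) ⟩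
    b K * + 1 - a K * + 1
      ≡⟨ cong₂ _-_ (ℤ.*-identityʳ (b K)) (ℤ.*-identityʳ (a K)) ⟩
    δ ∎

agree-suc : ∀ {k a b} → AgreeUpTo k a b → a (suc k) ≡ b (suc k) → AgreeUpTo (suc k) a b
agree-suc a≈b a≡b i i≤1+k with ℕ.m≤n⇒m<n∨m≡n i≤1+k
... | inj₁ (s≤s i≤k) = a≈b i i≤k
... | inj₂ refl      = a≡b

diagonal-agrees : (a : ℕ → Series) → (∀ k → AgreeUpTo k (a (suc k)) (a k)) →
                  ∀ k → AgreeUpTo k (λ i → a i i) (a k)
diagonal-agrees a stable zero    _ z≤n = refl
diagonal-agrees a stable (suc k)       =
  agree-suc (λ i i≤k → trans (diagonal-agrees a stable k i i≤k) (sym (stable k i i≤k))) refl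

addAt : Series → ℕ → ℤ → Series
addAt a k c j with j ℕ.≟ k
... | yes _ = a j + c
... | no  _ = a j

addAt-here : ∀ a k c → addAt a k c k ≡ a k + c
addAt-here a k c with k ℕ.≟ k
... | yes _   = refl
... | no k≢k = contradiction refl k≢k

addAt-below : ∀ a k c → AgreeUpTo k (addAt a (suc k) c) a
addAt-below a k c i i≤k with i ℕ.≟ suc k
... | yes refl = contradiction i≤k (ℕ.n≮n k)
... | no  _    = refl

module HenselLift {n r : ℕ} (rad : ∀ p → Prime p → p ∣ n → p ∣ r) {u f : Series}
                  (u∈R : InR u) (f∈R : InR f) (f≡uⁿ : CongMod f (u ^^ n) (n ℕ.* r)) where

  lift : Series → Series
  lift t k = u k + + r * t k

  lift-InR : ∀ {t} → t 0 ≡ + 0 → InR (lift t)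
  lift-InR t0≡0 = trans (cong₂ (λ x y → x + + r * y) u∈R t0≡0) (cong (_+_ (+ 1)) (ℤ.*-zeroʳ (+ r)))

  lift-agree : ∀ {k t t′} → AgreeUpTo k t t′ → AgreeUpTo k (lift t) (lift t′)
  lift-agree t≈t′ i i≤k = cong (λ x → u i + + r * x) (t≈t′ i i≤k)

  f≡liftⁿ : ∀ t → CongMod f (lift t ^^ n) (n ℕ.* r)
  f≡liftⁿ t = CongMod-trans {f} f≡uⁿ (CongMod-sym {lift t ^^ n} (CongMod-^^ n rad lift≡u))
    where
    lift≡u : CongMod (lift t) u r
    lift≡u k = ℤ.∣⇒∣ᵤ {+ r} (ℤ.divides (t k) (≡+*⇒-≡* {y = u k} {t k} {+ r} refl))

  correction : Series → ℕ → ℤ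
  correction t k = ℤ.quotient (CongMod⇒∣ {f} (f≡liftⁿ t) k)

  approx : ℕ → Series
  approx zero    = 0ₛ
  approx (suc k) = addAt (approx k) (suc k) (correction (approx k) (suc k))

  limit : Series
  limit k = approx k k

  limit-agrees : ∀ k → AgreeUpTo k limit (approx k)
  limit-agrees = diagonal-agrees approx (λ k → addAt-below (approx k) k _)

  approx-InR : ∀ k → InR (lift (approx k))
  approx-InR k = lift-InR {approx k} (sym (limit-agrees k 0 z≤n))

  lift-step : ∀ {k t} c → InR (lift t) → f (suc k) - (lift t ^^ n) (suc k) ≡ c * + (n ℕ.* r) →
              (lift (addAt t (suc k) c) ^^ n) (suc k) ≡ f (suc k)
  lift-step {k} {t} c lift∈R f-P≡c*nr = begin
    (lift (addAt t K c) ^^ n) K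
      ≡⟨ ^^-perturb n lift∈R (λ j j≤k → sym (lift-agree (addAt-below t k c) j j≤k)) ⟩
    P + + n * (lift (addAt t K c) K - lift t K)
      ≡⟨ cong (λ x → P + + n * (u K + + r * x - lift t K)) (addAt-here t K c) ⟩
    P + + n * (u K + + r * (t K + c) - (u K + + r * t K))
      ≡⟨ expand P (u K) (t K) c (+ n) (+ r) ⟩
    P + c * (+ n * + r)
      ≡⟨ cong (λ m → P + c * m) (sym (ℤ.pos-* n r)) ⟩
    P + c * + (n ℕ.* r)
      ≡⟨ cong (_+_ P) (sym f-P≡c*nr) ⟩
    P + (f K - P)
      ≡⟨ cancel P (f K) ⟩
    f K ∎
    where
    K : ℕ
    K = suc k
    P : ℤ
    P = (lift t ^^ n) K
    expand : ∀ P u t c n r → P + n * (u + r * (t + c) - (u + r * t)) ≡ P + c * (n * r)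
    expand = solve-∀
    cancel : ∀ P f → P + (f - P) ≡ f
    cancel = solve-∀

  approx-correct : ∀ k → AgreeUpTo k (lift (approx k) ^^ n) f
  approx-correct zero    _ z≤n = trans (^^-InR n (approx-InR 0)) (sym f∈R)
  approx-correct (suc k) = agree-suc
    (λ i i≤k → trans (^^-agree n (lift-agree (addAt-below (approx k) k _)) i i≤k) (approx-correct k i i≤k))
    (lift-step (correction (approx k) (suc k)) (approx-InR k)
               (ℤ._∣_.equality (CongMod⇒∣ {f} (f≡liftⁿ (approx k)) (suc k))))

  lift-power : InP n f
  lift-power = lift limit , lift-InR {limit} refl , λ k →
    sym (trans (^^-agree n (lift-agree (limit-agrees k)) k ℕ.≤-refl) (approx-correct k k ℕ.≤-refl))

radical : ℕ → ℕ
radical n = product (filter (λ p → prime? p ×-dec p ∣? n) (upTo (suc n)))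

prime∣⇒∣radical : ∀ {n p} → .{{NonZero n}} → Prime p → p ∣ n → p ∣ radical n
prime∣⇒∣radical {n} p-prime p∣n =
  ∈⇒∣product (∈-filter⁺ (λ p → prime? p ×-dec p ∣? n) (∈-upTo⁺ (s≤s (∣⇒≤ p∣n))) (p-prime , p∣n))

theorem1 : (n : ℕ) → n ≥ 1 → (f : Series) → InR f →
    (InP n f ⇔ Σ Series (λ h → InP n h × CongMod f h (μ n)))
theorem1 n n≥1 f f∈R = mk⇔ (λ f∈Pₙ → f , f∈Pₙ , CongMod-refl f (μ n)) from-congruent
  where
  instance
    n≢0 : NonZero n
    n≢0 = ℕ.>-nonZero n≥1
  from-congruent : Σ Series (λ h → InP n h × CongMod f h (μ n)) → InP n f
  from-congruent (h , (u , u∈R , h≈uⁿ) , f≡h) =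
    HenselLift.lift-power (λ _ → prime∣⇒∣radical) u∈R f∈R (CongMod-respʳ {f} h≈uⁿ f≡h)
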